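{- Fix a real number $0<r\le 1$ and let $k=\lfloor 1/r\rfloor$. Then there exists a constant $d_r$ with $0<d_r\le 1$ (depending only on $r$) such that for all sufficiently large positive integers $n$, \[ d_r\,\omega(n,k)\le Q(n,\lceil rn\rceil)\le \omega(n,k). \]
   Context: All graphs are finite and simple. For a graph $G$, $\omega(G)$, $\alpha(G)$ and $\chi(G)$ denote its clique number, independence number and chromatic number, and $|G|$ its number of vertices. For positive integers $n,k$, the inverse Ramsey number is $\omega(n,k)=\min\{\omega(G): |G|=n \text{ and } \alpha(G)\le k\}$. For positive integers $n,c$, $Q(n,c)=\min\{\omega(G): |G|=n \text{ and } \chi(G)=c\}$. -}

module Defs where

open import Data.Nat as ℕ using (ℕ; zero; suc)
open import Data.Integer as ℤ using (ℤ; +_)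
open import Data.Rational using (ℚ; _/_; 0ℚ; _<_)
open import Data.Bool using (Bool; true; false)
open import Data.Fin using (Fin)
open import Data.Fin.Subset using (Subset; _∈_; ∣_∣)
open import Data.Product using (Σ; _×_; ∃)
open import Data.Sum using (_⊎_)
open import Relation.Binary.PropositionalEquality using (_≡_; _≢_)
open import Relation.Nullary using (¬_)

record ℝ : Set₁ where
  field
    Lower     : ℚ → Set
    Upper     : ℚ → Set
    inhabitedL : ∃ Lower
    inhabitedU : ∃ Upper
    roundedL  : ∀ q → (Lower q → Σ ℚ (λ q' → q < q' × Lower q'))
                    × (Σ ℚ (λ q' → q < q' × Lower q') → Lower q)
    roundedU  : ∀ q → (Upper q → Σ ℚ (λ q' → q' < q × Upper q'))
                    × (Σ ℚ (λ q' → q' < q × Upper q') → Upper q)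
    disjoint  : ∀ q → ¬ (Lower q × Upper q)
    located   : ∀ q q' → q < q' → Lower q ⊎ Upper q'

open ℝ public

_<ℝ_ : ℚ → ℝ → Set
q <ℝ r = Lower r q

_ℝ≤_ : ℝ → ℚ → Set
r ℝ≤ q = ∀ p → Lower r p → p < q

-- the rational number p / n  (n ≥ 1; value 0 for n = 0, never used)
ratio : ℤ → ℕ → ℚ
ratio p zero    = 0ℚ
ratio p (suc m) = p / suc m

-- k = ⌊1/r⌋, i.e. 1/(k+1) < r ≤ 1/k (for 0 < r ≤ 1, so k ≥ 1)
IsFloorInv : ℝ → ℕ → Set
IsFloorInv r k = (1 ℕ.≤ k) × (r ℝ≤ ratio (+ 1) k) × (ratio (+ 1) (suc k) <ℝ r)

-- c = ⌈r n⌉ (n ≥ 1), i.e. c - 1 < r n ≤ c, i.e. (c-1)/n < r ≤ c/n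
IsCeil : ℝ → ℕ → ℕ → Set
IsCeil r n c = (r ℝ≤ ratio (+ c) n) × (ratio (+ c ℤ.- + 1) n <ℝ r)

record Graph (n : ℕ) : Set where
  field
    adj   : Fin n → Fin n → Bool
    sym   : ∀ x y → adj x y ≡ adj y x
    irrefl : ∀ x → adj x x ≡ false

open Graph public

IsClique : ∀ {n} → Graph n → Subset n → Set
IsClique G S = ∀ x y → x ∈ S → y ∈ S → x ≢ y → adj G x y ≡ true

IsIndependent : ∀ {n} → Graph n → Subset n → Set
IsIndependent G S = ∀ x y → x ∈ S → y ∈ S → adj G x y ≡ false

CliqueNumber : ∀ {n} → Graph n → ℕ → Set
CliqueNumber G w =
  Σ (Subset _) (λ S → IsClique G S × ∣ S ∣ ≡ w)
  × (∀ S → IsClique G S → ∣ S ∣ ℕ.≤ w)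

IndepAtMost : ∀ {n} → Graph n → ℕ → Set
IndepAtMost G k = ∀ S → IsIndependent G S → ∣ S ∣ ℕ.≤ k

IsProperColouring : ∀ {n} → Graph n → (c : ℕ) → (Fin n → Fin c) → Set
IsProperColouring G c f = ∀ x y → adj G x y ≡ true → f x ≢ f y

ChromaticNumber : ∀ {n} → Graph n → ℕ → Set
ChromaticNumber {n} G c =
  Σ (Fin n → Fin c) (IsProperColouring G c)
  × (∀ c' (f : Fin n → Fin c') → IsProperColouring G c' f → c ℕ.≤ c')

-- ω(n,k) = w : minimum of ω(G) over graphs G with |G| = n, α(G) ≤ k
InverseRamsey : ℕ → ℕ → ℕ → Set
InverseRamsey n k w =
  Σ (Graph n) (λ G → IndepAtMost G k × CliqueNumber G w)
  × (∀ (G : Graph n) w' → IndepAtMost G k → CliqueNumber G w' → w ℕ.≤ w')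

-- Q(n,c) = q : minimum of ω(G) over graphs G with |G| = n, χ(G) = c
QNum : ℕ → ℕ → ℕ → Set
QNum n c q =
  Σ (Graph n) (λ G → ChromaticNumber G c × CliqueNumber G q)
  × (∀ (G : Graph n) q' → ChromaticNumber G c → CliqueNumber G q' → q ℕ.≤ q')

-- Upper bound: a graph G with α(G) ≤ k and ω(G) = ω(n,k) has χ(G) ≥ n/k > ⌈rn⌉ - 1. Adding the
-- vertices of G one at a time raises the chromatic number by at most one per step, so some spanning
-- subgraph of G has chromatic number exactly ⌈rn⌉, and its clique number is at most ω(G).
--
-- Lower bound: take X with χ(X) = c = ⌈rn⌉ and ω(X) = Q(n,c). Greedily remove t independent sets of
-- size > k; the remaining set R has α(X[R]) ≤ k, and c ≤ t + |R| while t(k+1) + |R| ≤ n. Since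
-- r > 1/(k+1), this forces |R| ≥ n/b for a constant b depending only on r. Blowing every vertex of
-- X[R] up into a clique of at most b vertices yields an n-vertex graph with α ≤ k and ω ≤ b Q(n,c),
-- hence ω(n,k) ≤ b Q(n,c). Both bounds hold for every n ≥ 1.
module Submission where

open import Defs hiding (sym)
open import Data.Bool using (true; false)
import Data.Bool.Properties as Boolₚ
open import Data.Empty using (⊥-elim)
open import Data.Fin using (Fin; zero; suc; toℕ; fromℕ; inject₁; inject≤; combine; remQuot)
open import Data.Fin.Properties
  using (any?; all?; toℕ<n; toℕ-injective; toℕ-inject≤; inject₁-injective; inject≤-injective;
         fromℕ≢inject₁; combine-injective; combine-remQuot; injective⇒≤; suc-injective)
  renaming (_≟_ to _≟ᶠ_)
open import Data.Fin.Subset using (Subset; inside; outside; _∈_; _⊆_; ∣_∣; ⊤; _─_) renaming (⊥ to ∅)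
open import Data.Fin.Subset.Properties
  using (_∈?_; _⊆?_; anySubset?; ∣p∣≤n; ∣⊤∣≡n; ∈⊤; ∉⊥; drop-∷-⊆; x∈p∧x∉q⇒x∈p─q)
open import Data.Integer as ℤ using (+_; -[1+_])
import Data.Integer.Properties as ℤₚ
open import Data.Nat as ℕ using (ℕ; zero; suc; _+_; _*_; _≤_; _<_; _≤?_; _<?_; z≤n; s≤s)
open import Data.Nat.Induction using (<-wellFounded)
import Data.Nat.Properties as ℕₚ
open import Data.Nat.Tactic.RingSolver using (solve-∀)
open import Data.Product using (Σ; ∃; ∃-syntax; ∃₂; _×_; _,_; proj₁; proj₂; uncurry)
open import Data.Rational
  using (ℚ; mkℚ; _/_; 0ℚ; 1ℚ; toℚᵘ; *<*) renaming (_<_ to _<ℚ_; _≤_ to _≤ℚ_; _*_ to _*ℚ_)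
import Data.Rational.Properties as ℚₚ
import Data.Rational.Unnormalised as ℚᵘ
import Data.Rational.Unnormalised.Properties as ℚᵘₚ
open import Data.Sum using (_⊎_; inj₁; inj₂; [_,_]′)
open import Data.Vec using ([]; _∷_; here; there; tabulate)
import Data.Vec.Functional as Vector
open import Data.Vec.Properties using (lookup∘tabulate; lookup⇒[]=; []=⇒lookup)
open import Function using (_∘_)
open import Function.Definitions using (Injective)
open import Induction.WellFounded using (Acc; acc)
open import Relation.Binary.PropositionalEquality
  using (_≡_; _≢_; refl; trans; cong; cong₂; subst; subst₂; _≗_; module ≡-Reasoning)
  renaming (sym to ≡-sym)
open import Relation.Nullary using (¬_; Dec; yes; no; does; contradiction)
open import Relation.Nullary.Decidable
  using (dec-true; dec-false; map′; ¬?; _×-dec_; _⊎-dec_; _→-dec_)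
open import Relation.Unary as U using (Pred)

module _ {P : ℕ → Set} (P? : U.Decidable P) where

  allBelow⊎firstFailure : ∀ n → (∀ {i} → i < n → P i) ⊎ ∃[ j ] (¬ P j × (∀ {i} → i < j → P i))
  allBelow⊎firstFailure zero = inj₁ λ ()
  allBelow⊎firstFailure (suc n) with allBelow⊎firstFailure n
  ... | inj₂ failure = inj₂ failure
  ... | inj₁ below with P? n
  ...   | no ¬Pn = inj₂ (n , ¬Pn , below)
  ...   | yes Pn = inj₁ λ i<1+n → [ below , (λ { refl → Pn }) ]′ (ℕₚ.m<1+n⇒m<n∨m≡n i<1+n)

  firstFailure : ∀ {n} → ¬ P n → ∃[ j ] (¬ P j × (∀ {i} → i < j → P i))
  firstFailure {n} ¬Pn with allBelow⊎firstFailure (suc n)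
  ... | inj₁ below   = contradiction (below (ℕₚ.n<1+n n)) ¬Pn
  ... | inj₂ failure = failure

does≡true⇒ : ∀ {a} {A : Set a} (a? : Dec A) → does a? ≡ true → A
does≡true⇒ (yes a) _ = a

anyFunction? : ∀ {n m} {P : (Fin n → Fin m) → Set} →
               (∀ {f g} → f ≗ g → P f → P g) → U.Decidable P → Dec (∃ P)
anyFunction? {zero} resp P? = map′ (λ Pf → _ , Pf) (λ (f , Pf) → resp (λ ()) Pf) (P? λ ())
anyFunction? {suc n} resp P? =
  map′ (λ (a , f , Pf) → a Vector.∷ f , Pf) (λ (f , Pf) → f zero , f ∘ suc , resp η Pf)
       (any? λ a → anyFunction? (λ f≗g → resp (∷-cong f≗g)) (P? ∘ (a Vector.∷_)))
  where
  ∷-cong : ∀ {a f g} → f ≗ g → (a Vector.∷ f) ≗ (a Vector.∷ g)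
  ∷-cong f≗g zero    = refl
  ∷-cong f≗g (suc i) = f≗g i
  η : ∀ {f} → f ≗ (f zero Vector.∷ f ∘ suc)
  η zero    = refl
  η (suc i) = refl

enumerate : ∀ {n} (S : Subset n) → Fin ∣ S ∣ → Fin n
enumerate (inside  ∷ S) zero    = zero
enumerate (inside  ∷ S) (suc i) = suc (enumerate S i)
enumerate (outside ∷ S) i       = suc (enumerate S i)

enumerate-∈ : ∀ {n} (S : Subset n) i → enumerate S i ∈ S
enumerate-∈ (inside  ∷ S) zero    = here
enumerate-∈ (inside  ∷ S) (suc i) = there (enumerate-∈ S i)
enumerate-∈ (outside ∷ S) i       = there (enumerate-∈ S i)

enumerate-injective : ∀ {n} (S : Subset n) → Injective _≡_ _≡_ (enumerate S)
enumerate-injective (inside  ∷ S) {zero}  {zero}  _  = refl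
enumerate-injective (inside  ∷ S) {suc i} {suc j} eq =
  cong suc (enumerate-injective S (suc-injective eq))
enumerate-injective (outside ∷ S) eq = enumerate-injective S (suc-injective eq)

indexOf : ∀ {n} (S : Subset n) {x} → x ∈ S → Fin ∣ S ∣
indexOf (inside  ∷ S) here       = zero
indexOf (inside  ∷ S) (there x∈) = suc (indexOf S x∈)
indexOf (outside ∷ S) (there x∈) = indexOf S x∈

indexOf-injective : ∀ {n} {S : Subset n} {x y} (x∈ : x ∈ S) (y∈ : y ∈ S) →
                    indexOf S x∈ ≡ indexOf S y∈ → x ≡ y
indexOf-injective {S = inside  ∷ S} here       here       _  = refl
indexOf-injective {S = inside  ∷ S} (there x∈) (there y∈) eq =
  cong suc (indexOf-injective x∈ y∈ (suc-injective eq))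
indexOf-injective {S = outside ∷ S} (there x∈) (there y∈) eq = cong suc (indexOf-injective x∈ y∈ eq)

indexOf-injective′ : ∀ {n} {S T : Subset n} {x y} → S ≡ T → (x∈ : x ∈ S) (y∈ : y ∈ T) →
                     toℕ (indexOf S x∈) ≡ toℕ (indexOf T y∈) → x ≡ y
indexOf-injective′ refl x∈ y∈ eq = indexOf-injective x∈ y∈ (toℕ-injective eq)

∣p─q∣+∣q∣≤∣p∣ : ∀ {n} (p q : Subset n) → q ⊆ p → ∣ p ─ q ∣ + ∣ q ∣ ≤ ∣ p ∣
∣p─q∣+∣q∣≤∣p∣ [] [] _ = z≤n
∣p─q∣+∣q∣≤∣p∣ (inside ∷ p) (inside ∷ q) q⊆p =
  subst (_≤ suc ∣ p ∣) (≡-sym (ℕₚ.+-suc ∣ p ─ q ∣ ∣ q ∣)) (s≤s (∣p─q∣+∣q∣≤∣p∣ p q (drop-∷-⊆ q⊆p)))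
∣p─q∣+∣q∣≤∣p∣ (outside ∷ p) (inside ∷ q) q⊆p = contradiction (q⊆p here) λ ()
∣p─q∣+∣q∣≤∣p∣ (inside ∷ p) (outside ∷ q) q⊆p = s≤s (∣p─q∣+∣q∣≤∣p∣ p q (drop-∷-⊆ q⊆p))
∣p─q∣+∣q∣≤∣p∣ (outside ∷ p) (outside ∷ q) q⊆p = ∣p─q∣+∣q∣≤∣p∣ p q (drop-∷-⊆ q⊆p)

select : ∀ {n p} {P : Pred (Fin n) p} → U.Decidable P → Subset n
select P? = tabulate (λ x → does (P? x))

module _ {n p} {P : Pred (Fin n) p} (P? : U.Decidable P) where

  ∈-select⁺ : ∀ {x} → P x → x ∈ select P?
  ∈-select⁺ {x} Px = lookup⇒[]= x _ (trans (lookup∘tabulate _ x) (dec-true (P? x) Px))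

  ∈-select⁻ : ∀ {x} → x ∈ select P? → P x
  ∈-select⁻ {x} x∈ = does≡true⇒ (P? x) (trans (≡-sym (lookup∘tabulate _ x)) ([]=⇒lookup x∈))

∈-image? : ∀ {n m} (π : Fin n → Fin m) (S : Subset n) → U.Decidable λ z → ∃[ x ] (x ∈ S × π x ≡ z)
∈-image? π S z = any? λ x → x ∈? S ×-dec π x ≟ᶠ z

image : ∀ {n m} → (Fin n → Fin m) → Subset n → Subset m
image π S = select (∈-image? π S)

fibre : ∀ {n m} → (Fin n → Fin m) → Fin m → Subset n
fibre f a = select λ x → f x ≟ᶠ a

module _ {n m} (π : Fin n → Fin m) {S : Subset n} where

  ∈-image⁺ : ∀ {x} → x ∈ S → π x ∈ image π S
  ∈-image⁺ x∈ = ∈-select⁺ (∈-image? π S) (_ , x∈ , refl)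

  ∈-image⁻ : ∀ {z} → z ∈ image π S → ∃[ x ] (x ∈ S × π x ≡ z)
  ∈-image⁻ = ∈-select⁻ (∈-image? π S)

∣S∣≤∣image∣*b : ∀ {n m b} (π : Fin n → Fin m) (σ : Fin n → Fin b) {S : Subset n} →
                (∀ {x y} → x ∈ S → y ∈ S → π x ≡ π y → σ x ≡ σ y → x ≡ y) →
                ∣ S ∣ ≤ ∣ image π S ∣ * b
∣S∣≤∣image∣*b π σ {S} inj = injective⇒≤ code-injective
  where
  π[S]∋ : ∀ i → π (enumerate S i) ∈ image π S
  π[S]∋ i = ∈-image⁺ π (enumerate-∈ S i)
  code : Fin ∣ S ∣ → Fin (∣ image π S ∣ * _)
  code i = combine (indexOf (image π S) (π[S]∋ i)) (σ (enumerate S i))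
  code-injective : Injective _≡_ _≡_ code
  code-injective {i} {j} eq with combine-injective _ _ _ _ eq
  ... | eq₁ , eq₂ = enumerate-injective S
    (inj (enumerate-∈ S i) (enumerate-∈ S j) (indexOf-injective (π[S]∋ i) (π[S]∋ j) eq₁) eq₂)

∣fibre∣≤k⇒n≤m*k : ∀ {n m k} (f : Fin n → Fin m) → (∀ a → ∣ fibre f a ∣ ≤ k) → n ≤ m * k
∣fibre∣≤k⇒n≤m*k {n} {m} {k} f bound = injective⇒≤ code-injective
  where
  position : Fin n → Fin k
  position x = inject≤ (indexOf (fibre f (f x)) (∈-select⁺ (λ y → f y ≟ᶠ f x) refl)) (bound (f x))
  code : Fin n → Fin (m * k)
  code x = combine (f x) (position x)
  code-injective : Injective _≡_ _≡_ code
  code-injective {x} {y} eq with combine-injective (f x) _ (f y) _ eq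
  ... | fx≡fy , eq₂ = indexOf-injective′ (cong (fibre f) fx≡fy) _ _
    (trans (≡-sym (toℕ-inject≤ _ _)) (trans (cong toℕ eq₂) (toℕ-inject≤ _ _)))

fromRelation : ∀ {n} {E : Fin n → Fin n → Set} → (∀ x y → Dec (E x y)) →
               (∀ {x y} → E x y → E y x) → (∀ {x} → ¬ E x x) → Graph n
fromRelation {E = E} E? E-sym E-irrefl = record
  { adj = λ x y → does (E? x y) ; sym = adj-sym ; irrefl = λ x → dec-false (E? x x) E-irrefl }
  where
  adj-sym : ∀ x y → does (E? x y) ≡ does (E? y x)
  adj-sym x y with E? x y | E? y x
  ... | yes _  | yes _  = refl
  ... | no _   | no _   = refl
  ... | yes e  | no ¬e  = contradiction (E-sym e) ¬e
  ... | no ¬e  | yes e  = contradiction (E-sym e) ¬e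

adj⇒≢ : ∀ {n} (G : Graph n) {x y} → adj G x y ≡ true → x ≢ y
adj⇒≢ G {x} e refl = contradiction (trans (≡-sym e) (irrefl G x)) λ ()

infix 4 _⊑_
_⊑_ : ∀ {n} → Graph n → Graph n → Set
H ⊑ G = ∀ x y → adj H x y ≡ true → adj G x y ≡ true

⊑-clique : ∀ {n} {H G : Graph n} {S} → H ⊑ G → IsClique H S → IsClique G S
⊑-clique H⊑G S-clique x y x∈ y∈ x≢y = H⊑G x y (S-clique x y x∈ y∈ x≢y)

isClique? : ∀ {n} (G : Graph n) → U.Decidable (IsClique G)
isClique? G S = all? λ x → all? λ y →
  x ∈? S →-dec y ∈? S →-dec ¬? (x ≟ᶠ y) →-dec adj G x y Boolₚ.≟ true

isIndependent? : ∀ {n} (G : Graph n) → U.Decidable (IsIndependent G)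
isIndependent? G S = all? λ x → all? λ y → x ∈? S →-dec y ∈? S →-dec adj G x y Boolₚ.≟ false

module _ {n} (G : Graph n) where

  HasClique≥ : ℕ → Set
  HasClique≥ v = ∃[ S ] (IsClique G S × v ≤ ∣ S ∣)

  hasClique≥? : U.Decidable HasClique≥
  hasClique≥? v = anySubset? λ S → isClique? G S ×-dec v ≤? ∣ S ∣

  ¬HasClique>n : ¬ HasClique≥ (suc n)
  ¬HasClique>n (S , _ , n<∣S∣) = ℕₚ.<⇒≱ n<∣S∣ (∣p∣≤n S)

  cliqueNumber-exists : ∃ (CliqueNumber G)
  cliqueNumber-exists with firstFailure hasClique≥? ¬HasClique>n
  ... | zero , ¬HasClique≥0 , _ = contradiction (∅ , (λ _ _ x∈ → ⊥-elim (∉⊥ x∈)) , z≤n) ¬HasClique≥0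
  ... | suc w , ¬HasClique>w , below with below (ℕₚ.n<1+n w)
  ...   | S , S-clique , w≤∣S∣ =
    w , (S , S-clique , ℕₚ.≤-antisym (at-most S S-clique) w≤∣S∣) , at-most
    where
    at-most : ∀ S → IsClique G S → ∣ S ∣ ≤ w
    at-most S S-clique = ℕₚ.≮⇒≥ λ w<∣S∣ → ¬HasClique>w (S , S-clique , w<∣S∣)

cliqueNumber-≤ : ∀ {n B} (G : Graph n) → (∀ S → IsClique G S → ∣ S ∣ ≤ B) →
                 ∃[ w ] (CliqueNumber G w × w ≤ B)
cliqueNumber-≤ G bound with cliqueNumber-exists G
... | _ , ω@((S , S-clique , refl) , _) = _ , ω , bound S S-clique

inverseRamsey-≤ : ∀ {n k w B} → InverseRamsey n k w → (H : Graph n) → IndepAtMost H k →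
                  (∀ S → IsClique H S → ∣ S ∣ ≤ B) → w ≤ B
inverseRamsey-≤ (_ , w-min) H α≤k bound with cliqueNumber-≤ H bound
... | ωH , ωH-is , ωH≤B = ℕₚ.≤-trans (w-min H ωH α≤k ωH-is) ωH≤B

QNum-≤ : ∀ {n c q B} → QNum n c q → (H : Graph n) → ChromaticNumber H c →
         (∀ S → IsClique H S → ∣ S ∣ ≤ B) → q ≤ B
QNum-≤ (_ , q-min) H χH bound with cliqueNumber-≤ H bound
... | ωH , ωH-is , ωH≤B = ℕₚ.≤-trans (q-min H ωH χH ωH-is) ωH≤B

Colourable : ∀ {n} → Graph n → ℕ → Set
Colourable {n} G c = Σ (Fin n → Fin c) (IsProperColouring G c)

colourable? : ∀ {n} (G : Graph n) c → Dec (Colourable G c)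
colourable? G c = anyFunction? resp λ f → all? λ x → all? λ y →
  adj G x y Boolₚ.≟ true →-dec ¬? (f x ≟ᶠ f y)
  where
  resp : ∀ {f g} → f ≗ g → IsProperColouring G c f → IsProperColouring G c g
  resp f≗g proper x y e eq = proper x y e (trans (f≗g x) (trans eq (≡-sym (f≗g y))))

colourable-⊑ : ∀ {n c} {H G : Graph n} → H ⊑ G → Colourable G c → Colourable H c
colourable-⊑ H⊑G (f , proper) = f , λ x y e → proper x y (H⊑G x y e)

colourable-≤ : ∀ {n c c′} {G : Graph n} → c ≤ c′ → Colourable G c → Colourable G c′
colourable-≤ c≤c′ (f , proper) =
  (λ x → inject≤ (f x) c≤c′) , λ x y e eq → proper x y e (inject≤-injective _ _ _ _ eq)

chromaticNumber-intro : ∀ {n c} {G : Graph n} → Colourable G (suc c) → ¬ Colourable G c →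
                        ChromaticNumber G (suc c)
chromaticNumber-intro {G = G} col ¬col = col , λ c′ f proper →
  ℕₚ.≮⇒≥ λ c′<1+c → ¬col (colourable-≤ {G = G} (ℕₚ.≤-pred c′<1+c) (f , proper))

colourable⇒n≤k*c : ∀ {n k c} (G : Graph n) → IndepAtMost G k → Colourable G c → n ≤ k * c
colourable⇒n≤k*c {n} {k} {c} G α≤k (f , proper) =
  subst (n ≤_) (ℕₚ.*-comm c k) (∣fibre∣≤k⇒n≤m*k f λ a → α≤k (fibre f a) (fibre-independent a))
  where
  fibre-independent : ∀ a → IsIndependent G (fibre f a)
  fibre-independent a x y x∈ y∈ = Boolₚ.¬-not λ e → proper x y e
    (trans (∈-select⁻ (λ v → f v ≟ᶠ a) x∈) (≡-sym (∈-select⁻ (λ v → f v ≟ᶠ a) y∈)))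

-- Growing a graph vertex by vertex

↾-edge? : ∀ {n} (G : Graph n) (j : ℕ) (x y : Fin n) →
          Dec (toℕ x < j × toℕ y < j × adj G x y ≡ true)
↾-edge? G j x y = toℕ x <? j ×-dec toℕ y <? j ×-dec adj G x y Boolₚ.≟ true

_↾_ : ∀ {n} → Graph n → ℕ → Graph n
G ↾ j = fromRelation (↾-edge? G j)
  (λ (x<j , y<j , e) → y<j , x<j , trans (Graph.sym G _ _) e)
  (λ (_ , _ , e) → adj⇒≢ G e refl)

↾-⊑ : ∀ {n} (G : Graph n) j → G ↾ j ⊑ G
↾-⊑ G j x y e = proj₂ (proj₂ (does≡true⇒ (↾-edge? G j x y) e))

⊑-↾ : ∀ {n} (G : Graph n) → G ⊑ G ↾ n
⊑-↾ {n} G x y e = dec-true (↾-edge? G n x y) (toℕ<n x , toℕ<n y , e)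

↾zero-colourable : ∀ {n c} (G : Graph n) → Colourable (G ↾ 0) (suc c)
↾zero-colourable G =
  (λ _ → zero) , λ x y e → ⊥-elim (ℕₚ.n≮0 (proj₁ (does≡true⇒ (↾-edge? G 0 x y) e)))

↾suc-colourable : ∀ {n c} (G : Graph n) j → Colourable (G ↾ j) c → Colourable (G ↾ suc j) (suc c)
↾suc-colourable {n} {c} G j (f , proper) = f′ , proper′
  where
  f′ : Fin n → Fin (suc c)
  f′ x with toℕ x ℕ.≟ j
  ... | yes _ = fromℕ c
  ... | no _  = inject₁ (f x)
  proper′ : IsProperColouring (G ↾ suc j) (suc c) f′
  proper′ x y e eq with does≡true⇒ (↾-edge? G (suc j) x y) e
  ... | x<1+j , y<1+j , xy with toℕ x ℕ.≟ j | toℕ y ℕ.≟ j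
  ...   | yes x≡j | yes y≡j = adj⇒≢ G xy (toℕ-injective (trans x≡j (≡-sym y≡j)))
  ...   | yes _   | no _    = fromℕ≢inject₁ eq
  ...   | no _    | yes _   = fromℕ≢inject₁ (≡-sym eq)
  ...   | no x≢j  | no y≢j  = proper x y
    (dec-true (↾-edge? G j x y)
      (ℕₚ.≤∧≢⇒< (ℕₚ.≤-pred x<1+j) x≢j , ℕₚ.≤∧≢⇒< (ℕₚ.≤-pred y<1+j) y≢j , xy))
    (inject₁-injective eq)

chromaticSpanningSubgraph : ∀ {n c} (G : Graph n) → ¬ Colourable G c →
                            ∃[ H ] (H ⊑ G × ChromaticNumber H (suc c))
chromaticSpanningSubgraph {n} {c} G ¬col
  with firstFailure {P = λ j → Colourable (G ↾ j) c} (λ j → colourable? (G ↾ j) c) {n}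
                    (¬col ∘ colourable-⊑ {H = G} {G = G ↾ n} (⊑-↾ G))
... | j , ¬colⱼ , below =
  G ↾ j , ↾-⊑ G j , chromaticNumber-intro {G = G ↾ j} (colourable j below) ¬colⱼ
  where
  colourable : ∀ j → (∀ {i} → i < j → Colourable (G ↾ i) c) → Colourable (G ↾ j) (suc c)
  colourable zero    _     = ↾zero-colourable G
  colourable (suc i) below = ↾suc-colourable G i (below (ℕₚ.n<1+n i))

Q≤ω : ∀ {n k c q w} → k * c < n → InverseRamsey n k w → QNum n (suc c) q → q ≤ w
Q≤ω k*c<n ((G , α≤k , (_ , ω-max)) , _) Q
  with chromaticSpanningSubgraph G (ℕₚ.<⇒≱ k*c<n ∘ colourable⇒n≤k*c G α≤k)
... | H , H⊑G , χH = QNum-≤ Q H χH λ S S-clique → ω-max S (⊑-clique {H = H} {G = G} H⊑G S-clique)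

-- Greedy decomposition

record Decomposition {n} (G : Graph n) (k : ℕ) (V : Subset n) : Set where
  field
    parts    : ℕ
    rest     : Subset n
    rest-α   : ∀ S → S ⊆ rest → IsIndependent G S → ∣ S ∣ ≤ k
    counting : parts * suc k + ∣ rest ∣ ≤ ∣ V ∣
    colour   : ∀ {x} → x ∈ V → Fin (parts + ∣ rest ∣)
    proper   : ∀ {x y} (x∈ : x ∈ V) (y∈ : y ∈ V) → adj G x y ≡ true → colour x∈ ≢ colour y∈

module _ {n} (G : Graph n) (k : ℕ) where

  LargeIndependentIn : Subset n → Set
  LargeIndependentIn V = ∃[ S ] (S ⊆ V × IsIndependent G S × k < ∣ S ∣)

  decomposition-stop : ∀ V → ¬ LargeIndependentIn V → Decomposition G k V
  decomposition-stop V none = record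
    { parts    = 0
    ; rest     = V
    ; rest-α   = λ S S⊆V S-ind → ℕₚ.≮⇒≥ λ k<∣S∣ → none (S , S⊆V , S-ind , k<∣S∣)
    ; counting = ℕₚ.≤-refl
    ; colour   = indexOf V
    ; proper   = λ x∈ y∈ e eq → adj⇒≢ G e (indexOf-injective x∈ y∈ eq)
    }

  decomposition-step : ∀ {V S} → S ⊆ V → IsIndependent G S → k < ∣ S ∣ →
                       Decomposition G k (V ─ S) → Decomposition G k V
  decomposition-step {V} {S} S⊆V S-ind k<∣S∣ D = record
    { parts = suc parts ; rest = rest ; rest-α = rest-α ; counting = counting′
    ; colour = colour′ ; proper = proper′ }
    where
    open Decomposition D
    open ℕₚ.≤-Reasoning
    counting′ : suc parts * suc k + ∣ rest ∣ ≤ ∣ V ∣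
    counting′ = begin
      suc k + parts * suc k + ∣ rest ∣   ≡⟨ ℕₚ.+-assoc (suc k) _ _ ⟩
      suc k + (parts * suc k + ∣ rest ∣) ≤⟨ ℕₚ.+-mono-≤ k<∣S∣ counting ⟩
      ∣ S ∣ + ∣ V ─ S ∣                  ≡⟨ ℕₚ.+-comm ∣ S ∣ _ ⟩
      ∣ V ─ S ∣ + ∣ S ∣                  ≤⟨ ∣p─q∣+∣q∣≤∣p∣ V S S⊆V ⟩
      ∣ V ∣                              ∎
    colour′ : ∀ {x} → x ∈ V → Fin (suc parts + ∣ rest ∣)
    colour′ {x} x∈V with x ∈? S
    ... | yes _   = fromℕ _
    ... | no x∉S  = inject₁ (colour (x∈p∧x∉q⇒x∈p─q x∈V x∉S))
    proper′ : ∀ {x y} (x∈ : x ∈ V) (y∈ : y ∈ V) → adj G x y ≡ true → colour′ x∈ ≢ colour′ y∈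
    proper′ {x} {y} x∈ y∈ e eq with x ∈? S | y ∈? S
    ... | yes x∈S | yes y∈S = contradiction (trans (≡-sym e) (S-ind x y x∈S y∈S)) λ ()
    ... | yes _   | no _    = fromℕ≢inject₁ eq
    ... | no _    | yes _   = fromℕ≢inject₁ (≡-sym eq)
    ... | no _    | no _    = proper _ _ e (inject₁-injective eq)

  decompose : ∀ V → Decomposition G k V
  decompose V = go V (<-wellFounded ∣ V ∣)
    where
    go : ∀ V → Acc _<_ ∣ V ∣ → Decomposition G k V
    go V (acc rec) with anySubset? (λ S → S ⊆? V ×-dec isIndependent? G S ×-dec k <? ∣ S ∣)
    ... | no none = decomposition-stop V none
    ... | yes (S , S⊆V , S-ind , k<∣S∣) =
      decomposition-step S⊆V S-ind k<∣S∣ (go (V ─ S) (rec ∣V─S∣<∣V∣))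
      where
      ∣V─S∣<∣V∣ : ∣ V ─ S ∣ < ∣ V ∣
      ∣V─S∣<∣V∣ = ℕₚ.<-≤-trans (ℕₚ.m<m+n _ (ℕₚ.<-≤-trans (s≤s z≤n) k<∣S∣)) (∣p─q∣+∣q∣≤∣p∣ V S S⊆V)

-- Blow-ups

blowUp-edge? : ∀ {n m} (G : Graph m) (π : Fin n → Fin m) (x y : Fin n) →
               Dec (x ≢ y × (π x ≡ π y ⊎ adj G (π x) (π y) ≡ true))
blowUp-edge? G π x y = ¬? (x ≟ᶠ y) ×-dec (π x ≟ᶠ π y ⊎-dec adj G (π x) (π y) Boolₚ.≟ true)

-- Vertex x of the blow-up is a copy of π x; copies of one vertex form a clique.
blowUp : ∀ {n m} → Graph m → (Fin n → Fin m) → Graph n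
blowUp G π = fromRelation (blowUp-edge? G π)
  (λ { (x≢y , inj₁ e) → (x≢y ∘ ≡-sym) , inj₁ (≡-sym e)
     ; (x≢y , inj₂ e) → (x≢y ∘ ≡-sym) , inj₂ (trans (Graph.sym G _ _) e) })
  (λ (x≢x , _) → x≢x refl)

module _ {n m} (G : Graph m) (π : Fin n → Fin m) {S : Subset n} where

  blowUp-injectiveOn : IsIndependent (blowUp G π) S →
                       ∀ {x y} → x ∈ S → y ∈ S → π x ≡ π y → x ≡ y
  blowUp-injectiveOn S-ind {x} {y} x∈ y∈ eq with x ≟ᶠ y
  ... | yes x≡y = x≡y
  ... | no x≢y  = contradiction
    (trans (≡-sym (dec-true (blowUp-edge? G π x y) (x≢y , inj₁ eq))) (S-ind x y x∈ y∈)) λ ()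

  image-independent : IsIndependent (blowUp G π) S → IsIndependent G (image π S)
  image-independent S-ind z z′ z∈ z′∈ with ∈-image⁻ π z∈ | ∈-image⁻ π z′∈
  ... | x , x∈ , refl | x′ , x′∈ , refl with π x ≟ᶠ π x′
  ...   | yes eq = subst (λ v → adj G (π x) v ≡ false) eq (irrefl G (π x))
  ...   | no neq = Boolₚ.¬-not λ e → contradiction
    (trans (≡-sym (dec-true (blowUp-edge? G π x x′) (neq ∘ cong π , inj₂ e))) (S-ind x x′ x∈ x′∈))
    λ ()

  image-clique : IsClique (blowUp G π) S → IsClique G (image π S)
  image-clique S-clique z z′ z∈ z′∈ z≢z′ with ∈-image⁻ π z∈ | ∈-image⁻ π z′∈
  ... | x , x∈ , refl | x′ , x′∈ , refl
    with does≡true⇒ (blowUp-edge? G π x x′) (S-clique x x′ x∈ x′∈ (z≢z′ ∘ cong π))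
  ...   | _ , inj₁ eq = contradiction eq z≢z′
  ...   | _ , inj₂ e  = e

blowUp-indepAtMost : ∀ {n m k} (G : Graph m) (π : Fin n → Fin m) {R} → (∀ x → π x ∈ R) →
                     (∀ S → S ⊆ R → IsIndependent G S → ∣ S ∣ ≤ k) → IndepAtMost (blowUp G π) k
blowUp-indepAtMost G π {R} π∈R α≤k S S-ind = begin
  ∣ S ∣                ≤⟨ ∣S∣≤∣image∣*b π (λ _ → zero) (λ x∈ y∈ eq _ → π-injective x∈ y∈ eq) ⟩
  ∣ image π S ∣ * 1    ≡⟨ ℕₚ.*-identityʳ _ ⟩
  ∣ image π S ∣        ≤⟨ α≤k (image π S) image⊆R (image-independent G π S-ind) ⟩
  _                    ∎
  where
  open ℕₚ.≤-Reasoning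
  π-injective : ∀ {x y} → x ∈ S → y ∈ S → π x ≡ π y → x ≡ y
  π-injective = blowUp-injectiveOn G π S-ind
  image⊆R : image π S ⊆ R
  image⊆R z∈ with ∈-image⁻ π z∈
  ... | x , _ , refl = π∈R x

blowUp-cliques : ∀ {n m q b} (G : Graph m) (π : Fin n → Fin m) (σ : Fin n → Fin b) →
                 (∀ {x y} → π x ≡ π y → σ x ≡ σ y → x ≡ y) →
                 (∀ S → IsClique G S → ∣ S ∣ ≤ q) →
                 ∀ S → IsClique (blowUp G π) S → ∣ S ∣ ≤ q * b
blowUp-cliques {b = b} G π σ inj ω≤q S S-clique = ℕₚ.≤-trans
  (∣S∣≤∣image∣*b π σ (λ _ _ → inj)) (ℕₚ.*-monoˡ-≤ b (ω≤q (image π S) (image-clique G π S-clique)))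

-- The n vertices are spread over ∣ R ∣ * b slots, at most b per vertex of R.
module _ {n b} (R : Subset n) (n≤∣R∣*b : n ≤ ∣ R ∣ * b) where

  slot : Fin n → Fin ∣ R ∣ × Fin b
  slot x = remQuot b (inject≤ x n≤∣R∣*b)

  host : Fin n → Fin n
  host x = enumerate R (proj₁ (slot x))

  host-∈ : ∀ x → host x ∈ R
  host-∈ x = enumerate-∈ R _

  host-injective : ∀ {x y} → host x ≡ host y → proj₂ (slot x) ≡ proj₂ (slot y) → x ≡ y
  host-injective {x} {y} eq₁ eq₂ = inject≤-injective _ _ x y (begin
    inject≤ x n≤∣R∣*b         ≡⟨ combine-remQuot {∣ R ∣} b _ ⟨
    uncurry combine (slot x)  ≡⟨ cong₂ combine (enumerate-injective R eq₁) eq₂ ⟩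
    uncurry combine (slot y)  ≡⟨ combine-remQuot {∣ R ∣} b _ ⟩
    inject≤ y n≤∣R∣*b         ∎)
    where open ≡-Reasoning

ω≤Q*b : ∀ {n k c q w b} → InverseRamsey n k w → QNum n c q →
        (∀ t m → c ≤ t + m → t * suc k + m ≤ n → n ≤ m * b) → w ≤ q * b
ω≤Q*b {n} {k} IR ((X , (_ , χ-min) , (_ , ω≤q)) , _) n≤m*b =
  inverseRamsey-≤ IR (blowUp X π)
    (blowUp-indepAtMost X π (host-∈ rest n≤∣rest∣*b) rest-α)
    (blowUp-cliques X π _ (host-injective rest n≤∣rest∣*b) ω≤q)
  where
  open Decomposition (decompose X k ⊤)
  n≤∣rest∣*b : n ≤ ∣ rest ∣ * _
  n≤∣rest∣*b = n≤m*b parts ∣ rest ∣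
    (χ-min _ (λ x → colour (∈⊤ {x = x})) (λ _ _ → proper ∈⊤ ∈⊤))
    (subst (parts * suc k + ∣ rest ∣ ≤_) (∣⊤∣≡n n) counting)
  π : Fin n → Fin n
  π = host rest n≤∣rest∣*b

-- Arithmetic of the constants

-- The hypotheses are 1/(k+1) < p/s < c/n, c ≤ t + m and t(k+1) + m ≤ n, cleared of denominators.
n≤m*[s*k] : ∀ {n k s p c t m} → s < p * suc k → p * n < c * s → c ≤ t + m → t * suc k + m ≤ n →
            n ≤ m * (s * k)
n≤m*[s*k] {n} {k} {s} {p} {c} {t} {m} s<p[1+k] pn<cs c≤t+m t[1+k]+m≤n =
  ℕₚ.<⇒≤ (ℕₚ.+-cancelˡ-< (s * n) n (m * (s * k)) chain)
  where
  open ℕₚ.≤-Reasoning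
  chain : s * n + n < s * n + m * (s * k)
  chain = begin-strict
    s * n + n                     ≡⟨ identity₁ s n ⟩
    suc s * n                     ≤⟨ ℕₚ.*-monoˡ-≤ n s<p[1+k] ⟩
    p * suc k * n                 ≡⟨ identity₂ p k n ⟩
    suc k * (p * n)               <⟨ ℕₚ.*-monoʳ-< (suc k) pn<cs ⟩
    suc k * (c * s)               ≤⟨ ℕₚ.*-monoʳ-≤ (suc k) (ℕₚ.*-monoˡ-≤ s c≤t+m) ⟩
    suc k * ((t + m) * s)         ≡⟨ identity₃ k t m s ⟩
    (t * suc k + m + k * m) * s   ≤⟨ ℕₚ.*-monoˡ-≤ s (ℕₚ.+-monoˡ-≤ (k * m) t[1+k]+m≤n) ⟩
    (n + k * m) * s               ≡⟨ identity₄ n k m s ⟩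
    s * n + m * (s * k)           ∎
    where
    identity₁ : ∀ s n → s * n + n ≡ suc s * n
    identity₁ = solve-∀
    identity₂ : ∀ p k n → p * suc k * n ≡ suc k * (p * n)
    identity₂ = solve-∀
    identity₃ : ∀ k t m s → suc k * ((t + m) * s) ≡ (t * suc k + m + k * m) * s
    identity₃ = solve-∀
    identity₄ : ∀ n k m s → (n + k * m) * s ≡ s * n + m * (s * k)
    identity₄ = solve-∀

toℚᵘ-/ : ∀ a d → toℚᵘ (a / suc d) ℚᵘ.≃ ℚᵘ.mkℚᵘ a d
toℚᵘ-/ a d = ℚₚ.toℚᵘ-fromℚᵘ (ℚᵘ.mkℚᵘ a d)

/<⇒*< : ∀ {a d a′ d′} → + a / suc d <ℚ + a′ / suc d′ → a * suc d′ < a′ * suc d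
/<⇒*< {a} {d} {a′} {d′} lt =
  ℤₚ.drop‿+<+ (subst₂ ℤ._<_ (≡-sym (ℤₚ.pos-* a _)) (≡-sym (ℤₚ.pos-* a′ _)) (ℚᵘₚ.drop-*<*
    (ℚᵘₚ.<-respʳ-≃ (toℚᵘ-/ (+ a′) d′) (ℚᵘₚ.<-respˡ-≃ (toℚᵘ-/ (+ a) d) (ℚₚ.toℚᵘ-mono-< lt)))))

0<1/[1+b] : ∀ b → 0ℚ <ℚ + 1 / suc b
0<1/[1+b] b = ℚₚ.positive⁻¹ _ {{ℚₚ.normalize-pos 1 (suc b)}}

1/[1+b]≤1 : ∀ b → + 1 / suc b ≤ℚ 1ℚ
1/[1+b]≤1 b = ℚₚ.toℚᵘ-cancel-≤ (ℚᵘₚ.≤-respˡ-≃ (ℚᵘₚ.≃-sym (toℚᵘ-/ (+ 1) b))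
  (ℚᵘₚ.≤-respʳ-≃ (ℚᵘₚ.≃-sym (toℚᵘ-/ (+ 1) 0)) (ℚᵘ.*≤* (ℤ.+≤+ (s≤s z≤n)))))

1/b*w≤q : ∀ {b w q} → w ≤ q * suc b → (+ 1 / suc b) *ℚ (+ w / 1) ≤ℚ + q / 1
1/b*w≤q {b} {w} {q} w≤q[1+b] = ℚₚ.toℚᵘ-cancel-≤
  (ℚᵘₚ.≤-respˡ-≃ (ℚᵘₚ.≃-sym lhs) (ℚᵘₚ.≤-respʳ-≃ (ℚᵘₚ.≃-sym (toℚᵘ-/ (+ q) 0)) (ℚᵘ.*≤* cross)))
  where
  lhs : toℚᵘ ((+ 1 / suc b) *ℚ (+ w / 1)) ℚᵘ.≃ ℚᵘ.mkℚᵘ (+ 1) b ℚᵘ.* ℚᵘ.mkℚᵘ (+ w) 0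
  lhs = ℚᵘₚ.≃-trans (ℚₚ.toℚᵘ-homo-* (+ 1 / suc b) (+ w / 1))
                    (ℚᵘₚ.*-cong (toℚᵘ-/ (+ 1) b) (toℚᵘ-/ (+ w) 0))
  cross : (+ 1 ℤ.* + w) ℤ.* + 1 ℤ.≤ + q ℤ.* + suc (b * 1)
  cross rewrite ℤₚ.*-identityˡ (+ w) | ℤₚ.*-identityʳ (+ w) | ℕₚ.*-identityʳ b
              | ≡-sym (ℤₚ.pos-* q (suc b)) = ℤ.+≤+ w≤q[1+b]

nonNegative-form : ∀ x → 0ℚ <ℚ x → ∃₂ λ p s → x ≡ + p / suc s
nonNegative-form x@(mkℚ (+ p) s _) _ = p , s , ≡-sym (ℚₚ.↥p/↧p≡p x)
nonNegative-form (mkℚ -[1+ p ] s _) (*<* ())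

theorem1p2 : (r : ℝ) → 0ℚ <ℝ r → r ℝ≤ 1ℚ → (k : ℕ) → IsFloorInv r k →
    Σ ℚ (λ d → (0ℚ <ℚ d) × (d ≤ℚ 1ℚ) × Σ ℕ (λ N → ∀ n → N ≤ n → 1 ≤ n →
      ∀ c w q → IsCeil r n c → InverseRamsey n k w → QNum n c q →
        (d *ℚ ratio (+ w) 1 ≤ℚ ratio (+ q) 1) × (q ≤ w)))
theorem1p2 r _ _ (suc k) (_ , r≤1/[1+k] , 1/[2+k]<r) with proj₁ (roundedL r _) 1/[2+k]<r
... | x , 1/[2+k]<x , x<r with nonNegative-form x (ℚₚ.<-trans (0<1/[1+b] (suc k)) 1/[2+k]<x)
... | p , s , refl = + 1 / suc b , 0<1/[1+b] b , 1/[1+b]≤1 b , 0 , bounds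
  where
  -- Here ⌊1/r⌋ = k + 1 and 1/(k + 2) < p/(s + 1) < r; the blow-up factor is (s + 1)(k + 1).
  b : ℕ
  b = k + s * suc k
  s<p[2+k] : suc s < p * suc (suc k)
  s<p[2+k] = subst (_< p * suc (suc k)) (ℕₚ.*-identityˡ (suc s))
                   (/<⇒*< {1} {suc k} {p} {s} 1/[2+k]<x)
  bounds : ∀ n → 0 ≤ n → 1 ≤ n → ∀ c w q → IsCeil r n c → InverseRamsey n (suc k) w → QNum n c q →
           ((+ 1 / suc b) *ℚ ratio (+ w) 1 ≤ℚ ratio (+ q) 1) × (q ≤ w)
  bounds (suc n) _ _ zero _ _ (r≤0/n , _) _ _ =
    contradiction (/<⇒*< {p} {s} {0} {n} (r≤0/n x x<r)) ℕₚ.n≮0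
  bounds (suc n) _ _ (suc c) w q (r≤c/n , [c-1]/n<r) IR Q =
    1/b*w≤q {b} {w} {q} (ω≤Q*b IR Q n≤m*b) , Q≤ω k*c<n IR Q
    where
    pn<cs : p * suc n < suc c * suc s
    pn<cs = /<⇒*< {p} {s} {suc c} {n} (r≤c/n x x<r)
    n≤m*b : ∀ t m → suc c ≤ t + m → t * suc (suc k) + m ≤ suc n → suc n ≤ m * suc b
    n≤m*b t m = n≤m*[s*k] {suc n} {suc k} {suc s} {p} {suc c} {t} {m} s<p[2+k] pn<cs
    k*c<n : suc k * c < suc n
    k*c<n = subst₂ _<_ (ℕₚ.*-comm c (suc k)) (ℕₚ.*-identityˡ (suc n))
                       (/<⇒*< {c} {n} {1} {k} (r≤1/[1+k] _ [c-1]/n<r))
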